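{- Let $\Sigma$ be a transition-algebra signature, $E$ a set of atomic $\Sigma$-sentences and $\varphi$ an atomic $\Sigma$-sentence. The following are equivalent: (a) $E\models\varphi$; (b) $\mathfrak A^E\models\varphi$; (c) $E\vdash^b\varphi$.
   Context: Transition algebra (TA). A signature $\Sigma=(S,F\supseteq M,L)$ consists of a set $S$ of sorts, a family $F=\{F_{w,s}\}$ of sets of function symbols, a subfamily $M\subseteq F$ of monotonic function symbols, and a set $L$ of transition labels. A $\Sigma$-model $\mathfrak A$ is a many-sorted $(S,F)$-algebra (carriers may be empty) with relations $\lambda^{\mathfrak A}_s\subseteq\mathfrak A_s\times\mathfrak A_s$ ($\lambda\in L$, $s\in S$) such that every $\sigma\in M$ is monotone in each argument: if $(a_k,b)\in\lambda^{\mathfrak A}$ then $(\sigma^{\mathfrak A}(a_1,\dots,a_k,\dots,a_n),\sigma^{\mathfrak A}(a_1,\dots,b,\dots,a_n))\in\lambda^{\mathfrak A}$. Atomic $\Sigma$-sentences are $t_1=t_2$ and $t_1\stackrel{\lambda}\Rightarrow t_2$ for ground $(S,F)$-terms $t_1,t_2$ of the same sort and $\lambda\in L$; $\mathfrak A\models t_1=t_2$ iff $t_1^{\mathfrak A}=t_2^{\mathfrak A}$, and $\mathfrak A\models t_1\stackrel{\lambda}\Rightarrow t_2$ iff $(t_1^{\mathfrak A},t_2^{\mathfrak A})\in\lambda^{\mathfrak A}$. $E\models\varphi$ means every $\Sigma$-model satisfying all sentences of $E$ satisfies $\varphi$. The basic entailment relation $\vdash^b$ is the least entailment relation (family of relations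 between sets of sentences closed under monotonicity $\Gamma\supseteq\Phi\Rightarrow\Gamma\vdash\Phi$, transitivity, union $(\forall\phi\in\Phi.\,\Gamma\vdash\phi)\Rightarrow\Gamma\vdash\Phi$, and translation along signature morphisms) closed under the rules: (R) $\Gamma\vdash t=t$; (S) $\Gamma\vdash t_1=t_2\Rightarrow\Gamma\vdash t_2=t_1$; (T) $\Gamma\vdash t_1=t_2$ and $\Gamma\vdash t_2=t_3$ give $\Gamma\vdash t_1=t_3$; (F) $\Gamma\vdash t_i=t_i'$ ($1\le i\le n$) gives $\Gamma\vdash\sigma(t_1,\dots,t_n)=\sigma(t_1',\dots,t_n')$; (P) $\Gamma\vdash t_1=t_1'$, $\Gamma\vdash t_2=t_2'$, $\Gamma\vdash t_1\stackrel{\lambda}\Rightarrow t_2$ give $\Gamma\vdash t_1'\stackrel{\lambda}\Rightarrow t_2'$; (M) for $f\in M$, $\Gamma\vdash t_j\stackrel{\lambda}\Rightarrow u_j$ gives $\Gamma\vdash f(t_1,\dots,t_j,\dots,t_n)\stackrel{\lambda}\Rightarrow f(t_1,\dots,u_j,\dots,t_n)$. The model $\mathfrak A^E$: let $\equiv^E$ be the congruence on the ground term algebra $T_\Sigma$ given by $t_1\equiv^E t_2$ iff $E\vdash^b_\Sigma t_1=t_2$; $\mathfrak A^E$ is $T_\Sigma/{\equiv^E}$ with each $\lambda\in L$ interpreted as $\{([t_1],[t_2])\mid E\vdash^b_\Sigma t_1\stackrel{\lambda}\Rightarrow t_2\}$. -}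

module Defs where

open import Data.List using (List; []; _∷_)
open import Data.List.Relation.Unary.All using (All; []; _∷_)
open import Relation.Binary using (IsEquivalence)

record Signature : Set₁ where
  field
    Sort  : Set
    Fun   : List Sort → Sort → Set
    Mono  : ∀ {w s} → Fun w s → Set
    Label : Set

data Pw {S : Set} {C : S → Set} (R : ∀ {s} → C s → C s → Set) :
        ∀ {w : List S} → All C w → All C w → Set where
  []  : Pw R [] []
  _∷_ : ∀ {s w} {a b : C s} {as bs : All C w} →
        R a b → Pw R as bs → Pw R (a ∷ as) (b ∷ bs)

data AtOne {S : Set} {C : S → Set} (R : ∀ {s} → C s → C s → Set) :
           ∀ {w : List S} → All C w → All C w → Set where
  here  : ∀ {s w} {a b : C s} {as : All C w} →
          R a b → AtOne R (a ∷ as) (b ∷ as)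
  there : ∀ {s w} {a : C s} {as bs : All C w} →
          AtOne R as bs → AtOne R (a ∷ as) (a ∷ bs)

module _ (Σ : Signature) where
  open Signature Σ

  data Term : Sort → Set where
    app : ∀ {w s} → Fun w s → All Term w → Term s

  data Sen : Set where
    _≐_     : ∀ {s} → Term s → Term s → Sen
    _⇒⟨_⟩_ : ∀ {s} → Term s → Label → Term s → Sen

  -- Σ-models.  Since Agda has no quotient types, carriers are setoids
  --.  Carriers may be empty.

  record Model : Set₁ where
    field
      Carrier : Sort → Set
      _≈_     : ∀ {s} → Carrier s → Carrier s → Set
      ≈-equiv : ∀ {s} → IsEquivalence (_≈_ {s})
      op      : ∀ {w s} → Fun w s → All Carrier w → Carrier s
      op-cong : ∀ {w s} (σ : Fun w s) {as bs : All Carrier w} →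
                Pw _≈_ as bs → op σ as ≈ op σ bs
      rel     : Label → ∀ {s} → Carrier s → Carrier s → Set
      rel-resp : ∀ (λ' : Label) {s} {a a' b b' : Carrier s} →
                 a ≈ a' → b ≈ b' → rel λ' a b → rel λ' a' b'
      mono    : ∀ {w s} (σ : Fun w s) → Mono σ → ∀ (λ' : Label)
                {as bs : All Carrier w} →
                AtOne (rel λ') as bs → rel λ' (op σ as) (op σ bs)

  module _ (𝔄 : Model) where
    open Model 𝔄

    mutual
      ⟦_⟧ : ∀ {s} → Term s → Carrier s
      ⟦ app σ ts ⟧ = op σ ⟦ ts ⟧*

      ⟦_⟧* : ∀ {w} → All Term w → All Carrier w
      ⟦ [] ⟧*     = []
      ⟦ t ∷ ts ⟧* = ⟦ t ⟧ ∷ ⟦ ts ⟧*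

    _⊨_ : Sen → Set
    _⊨_ (t₁ ≐ t₂)       = ⟦ t₁ ⟧ ≈ ⟦ t₂ ⟧
    _⊨_ (t₁ ⇒⟨ λ' ⟩ t₂) = rel λ' ⟦ t₁ ⟧ ⟦ t₂ ⟧

  _⊨ₛ_ : (Sen → Set) → Sen → Set₁
  E ⊨ₛ φ = ∀ (𝔄 : Model) → (∀ ψ → E ψ → _⊨_ 𝔄 ψ) → _⊨_ 𝔄 φ

  data _⊢ᵇ_ (E : Sen → Set) : Sen → Set where
    ax   : ∀ {φ} → E φ → E ⊢ᵇ φ
    R    : ∀ {s} (t : Term s) → E ⊢ᵇ (t ≐ t)
    S    : ∀ {s} {t₁ t₂ : Term s} → E ⊢ᵇ (t₁ ≐ t₂) → E ⊢ᵇ (t₂ ≐ t₁)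
    T    : ∀ {s} {t₁ t₂ t₃ : Term s} →
           E ⊢ᵇ (t₁ ≐ t₂) → E ⊢ᵇ (t₂ ≐ t₃) → E ⊢ᵇ (t₁ ≐ t₃)
    F    : ∀ {w s} (σ : Fun w s) {ts us : All Term w} →
           Pw (λ t u → E ⊢ᵇ (t ≐ u)) ts us →
           E ⊢ᵇ (app σ ts ≐ app σ us)
    P    : ∀ {s} {λ' : Label} {t₁ t₁' t₂ t₂' : Term s} →
           E ⊢ᵇ (t₁ ≐ t₁') → E ⊢ᵇ (t₂ ≐ t₂') → E ⊢ᵇ (t₁ ⇒⟨ λ' ⟩ t₂) →
           E ⊢ᵇ (t₁' ⇒⟨ λ' ⟩ t₂')
    M    : ∀ {w s} (σ : Fun w s) → Mono σ → ∀ {λ' : Label}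
           {ts us : All Term w} →
           AtOne (λ t u → E ⊢ᵇ (t ⇒⟨ λ' ⟩ u)) ts us →
           E ⊢ᵇ (app σ ts ⇒⟨ λ' ⟩ app σ us)

  -- The model 𝔄^E = T_Σ / ≡^E  (as a setoid on ground terms)

  𝔄^ : (E : Sen → Set) → Model
  𝔄^ E = record
    { Carrier  = Term
    ; _≈_      = λ t u → E ⊢ᵇ (t ≐ u)
    ; ≈-equiv  = record { refl = R _ ; sym = S ; trans = T }
    ; op       = app
    ; op-cong  = F
    ; rel      = λ λ' t u → E ⊢ᵇ (t ⇒⟨ λ' ⟩ u)
    ; rel-resp = λ λ' p q r → P p q r
    ; mono     = λ σ m λ' a → M σ m a
    }

-- Soundness of the rules (R),(S),(T),(F),(P),(M) gives (c) ⇒ (a), and (a) ⇒ (b)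
-- because 𝔄^E is a model of E.  For (b) ⇔ (c): a ground term evaluates to itself
-- in the term model 𝔄^E, so 𝔄^E ⊨ φ is literally the statement E ⊢ᵇ φ.
module Submission where

open import Defs
open import Data.Product using (_×_; _,_)
open import Function.Bundles using (_⇔_; mk⇔; Equivalence)
open import Function.Properties.Equivalence using () renaming (refl to ⇔-refl)
open import Data.List.Relation.Unary.All using (All; []; _∷_)
open import Relation.Binary using (IsEquivalence)
open import Relation.Binary.PropositionalEquality using (_≡_; refl; cong; cong₂)

module _ (Σ : Signature) where
  open Signature Σ using (Label)

  module _ {E : Sen Σ → Set} (𝔅 : Model Σ) (𝔅⊨E : ∀ ψ → E ψ → _⊨_ Σ 𝔅 ψ) where
    open Model 𝔅
    private module ≈ {s} = IsEquivalence (≈-equiv {s})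

    mutual
      ⊢ᵇ-sound : ∀ {φ} → _⊢ᵇ_ Σ E φ → _⊨_ Σ 𝔅 φ
      ⊢ᵇ-sound (ax e)     = 𝔅⊨E _ e
      ⊢ᵇ-sound (R t)      = ≈.refl
      ⊢ᵇ-sound (S d)      = ≈.sym (⊢ᵇ-sound d)
      ⊢ᵇ-sound (T d e)    = ≈.trans (⊢ᵇ-sound d) (⊢ᵇ-sound e)
      ⊢ᵇ-sound (F σ ds)   = op-cong σ (Pw-sound ds)
      ⊢ᵇ-sound (P d e f)  = rel-resp _ (⊢ᵇ-sound d) (⊢ᵇ-sound e) (⊢ᵇ-sound f)
      ⊢ᵇ-sound (M σ m ds) = mono σ m _ (AtOne-sound ds)

      Pw-sound : ∀ {w} {ts us : All (Term Σ) w} →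
                 Pw (λ t u → _⊢ᵇ_ Σ E (t ≐ u)) ts us →
                 Pw _≈_ (⟦_⟧* Σ 𝔅 ts) (⟦_⟧* Σ 𝔅 us)
      Pw-sound []       = []
      Pw-sound (d ∷ ds) = ⊢ᵇ-sound d ∷ Pw-sound ds

      AtOne-sound : ∀ {w} {l : Label} {ts us : All (Term Σ) w} →
                    AtOne (λ t u → _⊢ᵇ_ Σ E (t ⇒⟨ l ⟩ u)) ts us →
                    AtOne (rel l) (⟦_⟧* Σ 𝔅 ts) (⟦_⟧* Σ 𝔅 us)
      AtOne-sound (here d)   = here (⊢ᵇ-sound d)
      AtOne-sound (there ds) = there (AtOne-sound ds)

  module _ (E : Sen Σ → Set) where

    mutual
      ⟦⟧-𝔄^ : ∀ {s} (t : Term Σ s) → ⟦_⟧ Σ (𝔄^ Σ E) t ≡ t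
      ⟦⟧-𝔄^ (app σ ts) = cong (app σ) (⟦⟧*-𝔄^ ts)

      ⟦⟧*-𝔄^ : ∀ {w} (ts : All (Term Σ) w) → ⟦_⟧* Σ (𝔄^ Σ E) ts ≡ ts
      ⟦⟧*-𝔄^ []       = refl
      ⟦⟧*-𝔄^ (t ∷ ts) = cong₂ _∷_ (⟦⟧-𝔄^ t) (⟦⟧*-𝔄^ ts)

    𝔄^⊨⇔⊢ᵇ : ∀ φ → _⊨_ Σ (𝔄^ Σ E) φ ⇔ _⊢ᵇ_ Σ E φ
    𝔄^⊨⇔⊢ᵇ (t₁ ≐ t₂)     rewrite ⟦⟧-𝔄^ t₁ | ⟦⟧-𝔄^ t₂ = ⇔-refl
    𝔄^⊨⇔⊢ᵇ (t₁ ⇒⟨ l ⟩ t₂) rewrite ⟦⟧-𝔄^ t₁ | ⟦⟧-𝔄^ t₂ = ⇔-refl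

    𝔄^-models : ∀ ψ → E ψ → _⊨_ Σ (𝔄^ Σ E) ψ
    𝔄^-models ψ e = Equivalence.from (𝔄^⊨⇔⊢ᵇ ψ) (ax e)

proposition3p7 : (Σ : Signature) (E : Sen Σ → Set) (φ : Sen Σ) →
    (_⊨ₛ_ Σ E φ ⇔ _⊨_ Σ (𝔄^ Σ E) φ) × (_⊨_ Σ (𝔄^ Σ E) φ ⇔ _⊢ᵇ_ Σ E φ)
proposition3p7 Σ E φ =
  mk⇔ (λ E⊨φ → E⊨φ (𝔄^ Σ E) (𝔄^-models Σ E))
      (λ 𝔄^⊨φ 𝔅 𝔅⊨E → ⊢ᵇ-sound Σ 𝔅 𝔅⊨E (to 𝔄^⊨φ))
  , 𝔄^⊨⇔⊢ᵇ Σ E φ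
  where open Equivalence (𝔄^⊨⇔⊢ᵇ Σ E φ)
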